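{- Let $k\ge1$, $n\ge1$, $m=kn+1$ and $D\in\mathcal D_{m,n}$. When the filling algorithm is run on $\mathrm{SW}(D)$, whenever the $i$-th letter ($2\le i\le m+n-1$) is $W$ there is at least one active entry; hence the algorithm terminates only after all entries $1,2,\dots,m+n-1$ have been placed.
   Context: $\mathcal D_{m,n}$ (coprime $m,n$) is the set of lattice paths from $(0,0)$ to $(m,n)$ with unit North and East steps staying weakly above the segment from $(0,0)$ to $(m,n)$; $\mathrm{SW}(D)$ is its step word ($S$ for North, $W$ for East). Filling algorithm: working in an array with $k+1$ rows and $n$ columns, place $1$ at the top of column 1; for $i=2,\dots,m+n-1$, if the $i$-th letter of $\mathrm{SW}(D)$ is $S$ place $i$ at the top of the leftmost empty column, and if it is $W$ place $i$ immediately below the smallest active entry, where an entry is active if it is currently the lowest entry of its column and is not in row $k+1$. -}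

module Defs where

open import Data.Nat using (ℕ; zero; suc; _+_; _*_; _∸_; _≤_; _<?_; _≤?_)
open import Data.List using (List; []; _∷_; length; replicate; take; filter)
open import Data.List.Relation.Unary.Any using (Any)
open import Data.Maybe using (Maybe; just; nothing; _>>=_)
open import Data.Product using (_×_; _,_)
open import Relation.Nullary using (yes; no)
open import Relation.Binary.PropositionalEquality using (_≡_)

data Step : Set where
  N E : Step

data Letter : Set where
  S W : Letter

letterOf : Step → Letter
letterOf N = S
letterOf E = W

SW : List Step → List Letter
SW [] = []
SW (x ∷ xs) = letterOf x ∷ SW xs

#N #E : List Step → ℕ
#N [] = 0
#N (N ∷ xs) = suc (#N xs)
#N (E ∷ xs) = #N xs
#E [] = 0
#E (N ∷ xs) = #E xs
#E (E ∷ xs) = suc (#E xs)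

-- D ∈ 𝒟_{m,n}: lattice path from (0,0) to (m,n) with N/E unit steps
-- staying weakly above the segment from (0,0) to (m,n): every lattice
-- point (x,y) visited satisfies y ≥ (n/m) x, i.e. x * n ≤ y * m.
record InD (m n : ℕ) (D : List Step) : Set where
  field
    endsE   : #E D ≡ m
    endsN   : #N D ≡ n
    weaklyAbove : ∀ j → #E (take j D) * n ≤ #N (take j D) * m

-- 1-indexed letter lookup: letterAt w i = i-th letter of w.
letterAt : {A : Set} → List A → ℕ → Maybe A
letterAt [] _ = nothing
letterAt (x ∷ xs) zero = nothing
letterAt (x ∷ xs) (suc zero) = just x
letterAt (x ∷ xs) (suc (suc i)) = letterAt xs (suc i)

-- State of the array: a list of the n columns (left to right); each column
-- is the list of its entries from the LOWEST entry to the top, so the head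
-- is the current lowest entry and the length is the row of that entry.
Column : Set
Column = List ℕ

State : Set
State = List Column

-- An entry is active if it is the lowest entry of its column and not in
-- row k+1, i.e. its column is nonempty with at most k entries.
IsActiveCol : ℕ → Column → Set
IsActiveCol k col = (1 ≤ length col) × (length col ≤ k)

HasActive : ℕ → State → Set
HasActive k s = Any (IsActiveCol k) s

activeHead : ℕ → Column → Maybe ℕ
activeHead k [] = nothing
activeHead k (x ∷ xs) with length (x ∷ xs) ≤? k
... | yes _ = just x
... | no _  = nothing

smallestActive : ℕ → ℕ → State → Maybe (ℕ × ℕ)
smallestActive k j [] = nothing
smallestActive k j (c ∷ cs) with activeHead k c | smallestActive k (suc j) cs
... | nothing | r = r
... | just v  | nothing = just (v , j)
... | just v  | just (v′ , j′) with v′ <? v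
...   | yes _ = just (v′ , j′)
...   | no _  = just (v , j)

leftmostEmpty : ℕ → State → Maybe ℕ
leftmostEmpty j [] = nothing
leftmostEmpty j ([] ∷ cs) = just j
leftmostEmpty j ((_ ∷ _) ∷ cs) = leftmostEmpty (suc j) cs

modifyAt : {A : Set} → ℕ → (A → A) → List A → List A
modifyAt _ f [] = []
modifyAt zero f (x ∷ xs) = f x ∷ xs
modifyAt (suc j) f (x ∷ xs) = x ∷ modifyAt j f xs

step : ℕ → ℕ → Letter → State → Maybe State
step k i S s with leftmostEmpty 0 s
... | nothing = nothing
... | just j  = just (modifyAt j (λ col → i ∷ col) s)
step k i W s with smallestActive k 0 s
... | nothing = nothing
... | just (_ , j) = just (modifyAt j (λ col → i ∷ col) s)

go : ℕ → ℕ → List Letter → State → Maybe State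
go k i [] s = just s
go k i (c ∷ cs) s = step k i c s >>= go k (suc i) cs

initial : ℕ → State
initial n = (1 ∷ []) ∷ replicate (n ∸ 1) []

dropOne : {A : Set} → List A → List A
dropOne [] = []
dropOne (_ ∷ xs) = xs

-- fill k n w: run the filling algorithm (array with k+1 rows, n columns)
-- on the word w: 1 placed at top of column 1, then for i = 2,3,...,|w|
-- entry i placed according to the i-th letter of w.
fill : ℕ → ℕ → List Letter → Maybe State
fill k n w = go k 2 (dropOne w) (initial n)

module Submission where

-- After a North and b East steps the array has a nonempty columns holding a + b entries, each
-- column of height at most k + 1. If no entry is active, every nonempty column is full, so
-- b = a k. The path lies weakly above the diagonal, so an East step taken from (a k, a) forces
-- (a k + 1) n ≤ a (k n + 1), i.e. a ≥ n; then b = k n = m − 1 and that East step is the last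
-- letter of SW(D), which the algorithm never reads. A North step always finds an empty column,
-- since a < n while North steps remain.

open import Defs
open import Data.Nat using (ℕ; zero; suc; _+_; _*_; _∸_; _≤_; _<_; z≤n; s≤s; _≤?_; _<?_)
open import Data.Nat.Properties
open import Data.Nat.Tactic.RingSolver using (solve-∀)
open import Data.List using (List; []; _∷_; take; length; replicate)
open import Data.List.Properties using (length-replicate)
open import Data.List.Relation.Unary.All using (All; []; _∷_)
open import Data.List.Relation.Unary.All.Properties using (replicate⁺)
open import Data.List.Relation.Unary.Any as Any using ()
open import Data.Maybe using (just; nothing)
open import Data.Product using (Σ; ∃; _×_; _,_; proj₁; proj₂)
open import Data.Sum using (_⊎_; inj₁; inj₂; [_,_])
open import Function using (id)
open import Relation.Nullary using (yes; no; contradiction)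
open import Relation.Binary.PropositionalEquality using (_≡_; _≢_; refl; sym; trans; cong; cong₂; subst; subst₂)

data At {A : Set} (P : A → Set) : ℕ → List A → Set where
  here  : ∀ {x xs} → P x → At P 0 (x ∷ xs)
  there : ∀ {d x xs} → At P d xs → At P (suc d) (x ∷ xs)

At-map : ∀ {A : Set} {P Q : A → Set} {d xs} → (∀ {x} → P x → Q x) → At P d xs → At Q d xs
At-map f (here p)  = here (f p)
At-map f (there p) = there (At-map f p)

length-modifyAt : ∀ {A : Set} d (f : A → A) xs → length (modifyAt d f xs) ≡ length xs
length-modifyAt _       f []       = refl
length-modifyAt zero    f (x ∷ xs) = refl
length-modifyAt (suc d) f (x ∷ xs) = cong suc (length-modifyAt d f xs)

place : ℕ → ℕ → State → State
place d i = modifyAt d (i ∷_)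

entries : State → ℕ
entries []       = 0
entries (c ∷ cs) = length c + entries cs

occupied : Column → ℕ
occupied []      = 0
occupied (_ ∷ _) = 1

occupiedColumns : State → ℕ
occupiedColumns []       = 0
occupiedColumns (c ∷ cs) = occupied c + occupiedColumns cs

Bounded : ℕ → State → Set
Bounded k = All (λ c → length c ≤ suc k)

entries-place : ∀ {P : Column → Set} {d s} i → At P d s → entries (place d i s) ≡ suc (entries s)
entries-place i (here _) = refl
entries-place {s = c ∷ cs} i (there p) =
  trans (cong (length c +_) (entries-place i p)) (+-suc (length c) (entries cs))

occupiedColumns-place-empty : ∀ {d s} i → At (_≡ []) d s →
  occupiedColumns (place d i s) ≡ suc (occupiedColumns s)
occupiedColumns-place-empty i (here refl) = refl
occupiedColumns-place-empty {s = c ∷ cs} i (there p) =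
  trans (cong (occupied c +_) (occupiedColumns-place-empty i p)) (+-suc (occupied c) (occupiedColumns cs))

occupiedColumns-place-nonempty : ∀ {d s} i → At (λ c → 1 ≤ length c) d s →
  occupiedColumns (place d i s) ≡ occupiedColumns s
occupiedColumns-place-nonempty i (here {_ ∷ _} _) = refl
occupiedColumns-place-nonempty {s = c ∷ cs} i (there p) = cong (occupied c +_) (occupiedColumns-place-nonempty i p)

Bounded-place : ∀ {k d s} i → At (λ c → length c ≤ k) d s → Bounded k s → Bounded k (place d i s)
Bounded-place i (here q)  (_ ∷ b) = s≤s q ∷ b
Bounded-place i (there p) (q ∷ b) = q ∷ Bounded-place i p b

record Filling (k n a b : ℕ) (s : State) : Set where
  field
    columns       : length s ≡ n
    occupiedCount : occupiedColumns s ≡ a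
    entryCount    : entries s ≡ a + b
    bounded       : Bounded k s

Filling-initial : ∀ k n → Filling k (suc n) 1 0 (initial (suc n))
Filling-initial k n = record
  { columns       = cong suc (length-replicate n)
  ; occupiedCount = cong suc (occupiedColumns-empty n)
  ; entryCount    = cong suc (entries-empty n)
  ; bounded       = s≤s z≤n ∷ replicate⁺ n z≤n
  }
  where
  occupiedColumns-empty : ∀ n → occupiedColumns (replicate n []) ≡ 0
  occupiedColumns-empty zero    = refl
  occupiedColumns-empty (suc n) = occupiedColumns-empty n
  entries-empty : ∀ n → entries (replicate n []) ≡ 0
  entries-empty zero    = refl
  entries-empty (suc n) = entries-empty n

Filling-openColumn : ∀ {k n a b s d} i → Filling k n a b s → At (_≡ []) d s →
  Filling k n (suc a) b (place d i s)
Filling-openColumn {s = s} {d} i f p = record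
  { columns       = trans (length-modifyAt d (i ∷_) s) columns
  ; occupiedCount = trans (occupiedColumns-place-empty i p) (cong suc occupiedCount)
  ; entryCount    = trans (entries-place i p) (cong suc entryCount)
  ; bounded       = Bounded-place i (At-map (λ { refl → z≤n }) p) bounded
  }
  where open Filling f

Filling-extendColumn : ∀ {k n a b s d} i → Filling k n a b s → At (IsActiveCol k) d s →
  Filling k n a (suc b) (place d i s)
Filling-extendColumn {a = a} {b} {s} {d} i f p = record
  { columns       = trans (length-modifyAt d (i ∷_) s) columns
  ; occupiedCount = trans (occupiedColumns-place-nonempty i (At-map proj₁ p)) occupiedCount
  ; entryCount    = trans (entries-place i p) (trans (cong suc entryCount) (sym (+-suc a b)))
  ; bounded       = Bounded-place i (At-map proj₂ p) bounded
  }
  where open Filling f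

hasActive⊎saturated : ∀ k s → Bounded k s → HasActive k s ⊎ entries s ≡ occupiedColumns s * suc k
hasActive⊎saturated k [] [] = inj₂ refl
hasActive⊎saturated k ([] ∷ cs) (_ ∷ b) with hasActive⊎saturated k cs b
... | inj₁ h   = inj₁ (Any.there h)
... | inj₂ sat = inj₂ sat
hasActive⊎saturated k ((x ∷ xs) ∷ cs) (p ∷ b) with suc (length xs) ≤? k
... | yes q = inj₁ (Any.here (s≤s z≤n , q))
... | no q with hasActive⊎saturated k cs b
...   | inj₁ h   = inj₁ (Any.there h)
...   | inj₂ sat = inj₂ (cong₂ _+_ (≤-antisym p (≰⇒> q)) sat)

leftmostEmpty-found : ∀ j s → occupiedColumns s < length s →
  ∃ λ d → leftmostEmpty j s ≡ just (j + d) × At (_≡ []) d s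
leftmostEmpty-found j ([] ∷ cs) _ = 0 , cong just (sym (+-identityʳ j)) , here refl
leftmostEmpty-found j ((_ ∷ _) ∷ cs) (s≤s lt) with leftmostEmpty-found (suc j) cs lt
... | d , eq , p = suc d , trans eq (cong just (sym (+-suc j d))) , there p

activeHead-sound : ∀ k c {v} → activeHead k c ≡ just v → IsActiveCol k c
activeHead-sound k (x ∷ xs) eq with length (x ∷ xs) ≤? k
... | yes q = s≤s z≤n , q

activeHead-complete : ∀ k c → IsActiveCol k c → ∃ λ v → activeHead k c ≡ just v
activeHead-complete k (x ∷ xs) (_ , q) with length (x ∷ xs) ≤? k
... | yes _  = x , refl
... | no ¬q = contradiction q ¬q

smallestActive-complete : ∀ k j s → HasActive k s → ∃ λ p → smallestActive k j s ≡ just p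
smallestActive-complete k j (c ∷ cs) h
  with activeHead k c in eqc | smallestActive k (suc j) cs in eqs
... | nothing | just p  = p , refl
... | just v  | nothing = (v , j) , refl
... | just v  | just (v′ , j′) with v′ <? v
...   | yes _ = (v′ , j′) , refl
...   | no _  = (v , j) , refl
smallestActive-complete k j (c ∷ cs) (Any.here a) | nothing | nothing =
  contradiction (trans (sym eqc) (proj₂ (activeHead-complete k c a))) λ ()
smallestActive-complete k j (c ∷ cs) (Any.there h) | nothing | nothing =
  contradiction (trans (sym eqs) (proj₂ (smallestActive-complete k (suc j) cs h))) λ ()

atHead : ∀ {P : Column → Set} {j c cs} → P c → ∃ λ d → j ≡ j + d × At P d (c ∷ cs)
atHead {j = j} p = 0 , sym (+-identityʳ j) , here p

atTail : ∀ {P : Column → Set} {j j′ c cs} →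
  (∃ λ d → j′ ≡ suc j + d × At P d cs) → ∃ λ d → j′ ≡ j + d × At P d (c ∷ cs)
atTail {j = j} (d , e , p) = suc d , trans e (sym (+-suc j d)) , there p

smallestActive-sound : ∀ k j s {v j′} → smallestActive k j s ≡ just (v , j′) →
  ∃ λ d → j′ ≡ j + d × At (IsActiveCol k) d s
smallestActive-sound k j (c ∷ cs) eq
  with activeHead k c in eqc | smallestActive k (suc j) cs in eqs
... | nothing | just _ = atTail (smallestActive-sound k (suc j) cs (trans eqs eq))
smallestActive-sound k j (c ∷ cs) refl | just w | nothing = atHead (activeHead-sound k c eqc)
smallestActive-sound k j (c ∷ cs) eq   | just w | just (v′ , _) with v′ <? w
... | yes _ = atTail (smallestActive-sound k (suc j) cs (trans eqs eq))
smallestActive-sound k j (c ∷ cs) refl | just w | just _ | no _ = atHead (activeHead-sound k c eqc)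

stepS-Filling : ∀ {k n a b s} i → Filling k n a b s → a < n →
  ∃ λ s′ → step k i S s ≡ just s′ × Filling k n (suc a) b s′
stepS-Filling {s = s} i f a<n
  with leftmostEmpty-found 0 s (subst₂ _<_ (sym (Filling.occupiedCount f)) (sym (Filling.columns f)) a<n)
... | d , eq , p rewrite eq = place d i s , refl , Filling-openColumn i f p

stepW-Filling : ∀ {k n a b s} i → Filling k n a b s → HasActive k s →
  ∃ λ s′ → step k i W s ≡ just s′ × Filling k n a (suc b) s′
stepW-Filling {k} {s = s} i f h with smallestActive k 0 s in eq
... | nothing = contradiction (trans (sym eq) (proj₂ (smallestActive-complete k 0 s h))) λ ()
... | just (v , j) with smallestActive-sound k 0 s eq
...   | d , refl , p = place d i s , refl , Filling-extendColumn i f p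

-- The part D of a path in 𝒟_{m,n} still to be walked from the lattice point (b, a).
record InDFrom (m n a b : ℕ) (D : List Step) : Set where
  field
    endsE       : b + #E D ≡ m
    endsN       : a + #N D ≡ n
    weaklyAbove : ∀ j → (b + #E (take j D)) * n ≤ (a + #N (take j D)) * m

InD⇒InDFrom : ∀ {m n D} → InD m n (N ∷ D) → InDFrom m n 1 0 D
InD⇒InDFrom d = record
  { endsE       = InD.endsE d
  ; endsN       = InD.endsN d
  ; weaklyAbove = λ j → InD.weaklyAbove d (suc j)
  }

InDFrom-N : ∀ {m n a b D} → InDFrom m n a b (N ∷ D) → InDFrom m n (suc a) b D
InDFrom-N {m} {n} {a} {b} {D} p = record
  { endsE       = endsE
  ; endsN       = trans (sym (+-suc a (#N D))) endsN
  ; weaklyAbove = λ j → subst (λ y → (b + #E (take j D)) * n ≤ y * m)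
                              (+-suc a (#N (take j D))) (weaklyAbove (suc j))
  }
  where open InDFrom p

InDFrom-E : ∀ {m n a b D} → InDFrom m n a b (E ∷ D) → InDFrom m n a (suc b) D
InDFrom-E {m} {n} {a} {b} {D} p = record
  { endsE       = trans (sym (+-suc b (#E D))) endsE
  ; endsN       = endsN
  ; weaklyAbove = λ j → subst (λ x → x * n ≤ (a + #N (take j D)) * m)
                              (+-suc b (#E (take j D))) (weaklyAbove (suc j))
  }
  where open InDFrom p

InDFrom-N⇒< : ∀ {m n a b D} → InDFrom m n a b (N ∷ D) → a < n
InDFrom-N⇒< {a = a} p = subst (a <_) (InDFrom.endsN p) (m<m+n a (s≤s z≤n))

length≡#E+#N : ∀ D → length D ≡ #E D + #N D
length≡#E+#N []      = refl
length≡#E+#N (N ∷ D) = trans (cong suc (length≡#E+#N D)) (sym (+-suc (#E D) (#N D)))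
length≡#E+#N (E ∷ D) = cong suc (length≡#E+#N D)

saturated-east-isLast : ∀ k n a e c → (a * k + 1) * n ≤ a * (k * n + 1) →
  a + c ≡ n → a * k + suc e ≡ k * n + 1 → e + c ≡ 0
saturated-east-isLast k n a e c above ac≡n east = cong₂ _+_ e≡0 c≡0
  where
  n≤a : n ≤ a
  n≤a = +-cancelˡ-≤ (a * k * n) n a
          (subst₂ _≤_ (expandˡ a k n) (expandʳ a k n) above)
    where
    expandˡ : ∀ a k n → (a * k + 1) * n ≡ a * k * n + n
    expandˡ = solve-∀
    expandʳ : ∀ a k n → a * (k * n + 1) ≡ a * k * n + a
    expandʳ = solve-∀
  a≡n : a ≡ n
  a≡n = ≤-antisym (subst (a ≤_) ac≡n (m≤m+n a c)) n≤a
  c≡0 : c ≡ 0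
  c≡0 = +-cancelˡ-≡ a c 0 (trans ac≡n (trans (sym a≡n) (sym (+-identityʳ a))))
  e≡0 : e ≡ 0
  e≡0 = suc-injective (+-cancelˡ-≡ (a * k) (suc e) 1
          (trans east (trans (cong (λ x → k * x + 1) (sym a≡n)) (cong (_+ 1) (*-comm k a)))))

¬saturated-beforeEast : ∀ {k n a b s D} → Filling k n a b s → InDFrom (k * n + 1) n a b (E ∷ D) →
  1 ≤ length D → entries s ≢ occupiedColumns s * suc k
¬saturated-beforeEast {k} {n} {a} {b} {D = D} f p 1≤len sat = contradiction 1≤0 λ ()
  where
  open Filling f
  open InDFrom p
  b≡ak : b ≡ a * k
  b≡ak = +-cancelˡ-≡ a b (a * k)
           (trans (sym entryCount) (trans sat (trans (cong (_* suc k) occupiedCount) (*-suc a k))))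
  above : (a * k + 1) * n ≤ a * (k * n + 1)
  above = subst₂ _≤_ (cong (λ x → (x + 1) * n) b≡ak) (cong (_* (k * n + 1)) (+-identityʳ a))
            (weaklyAbove 1)
  restEmpty : #E D + #N D ≡ 0
  restEmpty = saturated-east-isLast k n a (#E D) (#N D) above endsN
                (subst (λ x → x + suc (#E D) ≡ k * n + 1) b≡ak endsE)
  1≤0 : 1 ≤ 0
  1≤0 = subst (1 ≤_) (trans (length≡#E+#N D) restEmpty) 1≤len

hasActive-beforeEast : ∀ {k n a b s D} → Filling k n a b s → InDFrom (k * n + 1) n a b (E ∷ D) →
  1 ≤ length D → HasActive k s
hasActive-beforeEast {k} {s = s} f p 1≤len =
  [ id , (λ sat → contradiction sat (¬saturated-beforeEast f p 1≤len)) ]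
    (hasActive⊎saturated k s (Filling.bounded f))

run : ∀ {k n a b s} D i → Filling k n a b s → InDFrom (k * n + 1) n a b D → ∀ t → suc t ≤ length D →
  ∃ λ s′ → go k i (take t (SW D)) s ≡ just s′ ×
           (suc t < length D → letterAt (SW D) (suc t) ≡ just W → HasActive k s′)
run {s = s} (N ∷ D) i f p zero _ = s , refl , λ _ ()
run {s = s} (E ∷ D) i f p zero _ = s , refl , λ 1<len _ → hasActive-beforeEast f p (≤-pred 1<len)
run (N ∷ D) i f p (suc t) (s≤s t<len) with stepS-Filling i f (InDFrom-N⇒< p)
... | s₁ , eq , f₁ rewrite eq with run D (suc i) f₁ (InDFrom-N p) t t<len
...   | s′ , eq′ , active = s′ , eq′ , λ lt → active (≤-pred lt)
run (E ∷ D) i f p (suc t) (s≤s t<len) with stepW-Filling i f (hasActive-beforeEast f p (≤-trans (s≤s z≤n) t<len))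
... | s₁ , eq , f₁ rewrite eq with run D (suc i) f₁ (InDFrom-E p) t t<len
...   | s′ , eq′ , active = s′ , eq′ , λ lt → active (≤-pred lt)

run-complete : ∀ {k n a b s} D i → Filling k n a b s → InDFrom (k * n + 1) n a b D → 1 ≤ length D →
  ∃ λ s′ → go k i (take (length D ∸ 1) (SW D)) s ≡ just s′
run-complete (y ∷ D) i f p _ with s′ , eq , _ ← run (y ∷ D) i f p (length D) ≤-refl = s′ , eq

dropOne-take : ∀ {A : Set} M (x : A) xs → dropOne (take M (x ∷ xs)) ≡ take (M ∸ 1) xs
dropOne-take zero    x xs = refl
dropOne-take (suc M) x xs = refl

lemma2p4 : (k n : ℕ) → 1 ≤ k → 1 ≤ n →
    (D : List Step) → InD (k * n + 1) n D →
    ((i : ℕ) → 2 ≤ i → i ≤ (k * n + 1) + n ∸ 1 → letterAt (SW D) i ≡ just W →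
    Σ State (λ s → (fill k n (take (i ∸ 1) (SW D)) ≡ just s) × HasActive k s))
    × Σ State (λ s → fill k n (take ((k * n + 1) + n ∸ 1) (SW D)) ≡ just s)
lemma2p4 k (suc n) _ _ [] d with InD.endsN d
... | ()
lemma2p4 k (suc n) _ _ (E ∷ D) d with InD.weaklyAbove d 1
... | ()
lemma2p4 k n@(suc n′) _ _ (N ∷ D) d = activeAtEachW , completes
  where
  M = (k * n + 1) + n ∸ 1
  length≡M : length D ≡ M
  length≡M = cong (_∸ 1) (trans (length≡#E+#N (N ∷ D)) (cong₂ _+_ (InD.endsE d) (InD.endsN d)))
  nonempty : 1 ≤ length D
  nonempty = ≤-trans (subst (1 ≤_) (sym (InD.endsE d)) (m≤n+m 1 (k * n)))
                     (subst (#E D ≤_) (sym (length≡#E+#N D)) (m≤m+n (#E D) (#N D)))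
  start = Filling-initial k n′
  path = InD⇒InDFrom d
  activeAtEachW : (i : ℕ) → 2 ≤ i → i ≤ M → letterAt (SW (N ∷ D)) i ≡ just W →
    Σ State (λ s → (fill k n (take (i ∸ 1) (SW (N ∷ D))) ≡ just s) × HasActive k s)
  activeAtEachW (suc (suc i)) _ i≤M w =
    let i<len = subst (suc (suc i) ≤_) (sym length≡M) i≤M
        (s′ , eq , active) = run D 2 start path i (<⇒≤ i<len)
    in s′ , eq , active i<len w
  completes : Σ State (λ s → fill k n (take M (SW (N ∷ D))) ≡ just s)
  completes with s′ , eq ← run-complete D 2 start path nonempty =
    s′ , trans (cong (λ w → go k 2 w (initial n)) (dropOne-take M S (SW D)))
               (trans (cong (λ L → go k 2 (take (L ∸ 1) (SW D)) (initial n)) (sym length≡M)) eq)
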